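{- Let $G$ be a finite simple graph and $\mathcal{F}$ a nonempty autonomously dominating family of $G$. For every independent set $I$ of vertices of $G$ there is $S\in\mathcal{F}$ with $I\subseteq S$.
   Context: For $G=(V,E)$: two dominating sets $S,S'$ are adjacent if there are $v\in S$, $v'\in S'$ with $vv'\in E$ and $S'=(S\setminus\{v\})\cup\{v'\}$. A collection $\mathcal{F}$ of subsets of $V$ is an autonomously dominating family if: (1) every member is a dominating set; (2) for each $S\in\mathcal{F}$ and each $v\in V\setminus S$ there is $S'\in\mathcal{F}$ adjacent to $S$ with $v\in S'$; (3) for each $S\in\mathcal{F}$, every dominating set adjacent to $S$ belongs to $\mathcal{F}$. -}

module Defs where

open import Data.Nat using (ℕ)
open import Data.Fin using (Fin)
open import Data.Fin.Subset using (Subset; _∈_; _∉_; _⊆_; inside; outside)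
open import Data.Vec using (_[_]≔_)
open import Data.Product using (Σ; ∃; _×_; _,_)
open import Data.Sum using (_⊎_)
open import Relation.Nullary using (¬_; Dec)
open import Relation.Binary.PropositionalEquality using (_≡_)
open import Level using (0ℓ)

record Graph (n : ℕ) : Set₁ where
  field
    Adj      : Fin n → Fin n → Set
    sym      : ∀ {u v} → Adj u v → Adj v u
    irrefl   : ∀ {u} → ¬ Adj u u
    adj?     : ∀ u v → Dec (Adj u v)

module _ {n : ℕ} (G : Graph n) where
  open Graph G

  Dominating : Subset n → Set
  Dominating S = ∀ u → u ∈ S ⊎ Σ (Fin n) (λ w → w ∈ S × Adj u w)

  Independent : Subset n → Set
  Independent I = ∀ u v → u ∈ I → v ∈ I → ¬ Adj u v

  swap : Subset n → Fin n → Fin n → Subset n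
  swap S v v' = (S [ v ]≔ outside) [ v' ]≔ inside

  AdjacentDS : Subset n → Subset n → Set
  AdjacentDS S S' =
    Dominating S × Dominating S' ×
    Σ (Fin n) λ v → Σ (Fin n) λ v' →
      v ∈ S × v' ∈ S' × Adj v v' × S' ≡ swap S v v'

  Family : Set₁
  Family = Subset n → Set

  record AutonomouslyDominating (𝓕 : Family) : Set where
    field
      dominating : ∀ S → 𝓕 S → Dominating S
      extend     : ∀ S → 𝓕 S → ∀ v → v ∉ S →
                     Σ (Subset n) λ S' → 𝓕 S' × AdjacentDS S S' × v ∈ S'
      closed     : ∀ S → 𝓕 S → ∀ S' → AdjacentDS S S' → 𝓕 S'

-- Walk through the vertices one at a time, maintaining a member of the family
-- that contains every vertex of I seen so far. When the next vertex v ∈ I is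
-- missing, condition (2) supplies an adjacent member S' containing v. The swap
-- must bring in v itself and removes a neighbour x of v; by independence x ∉ I,
-- so every vertex of I already covered survives.
module Submission where

open import Defs
open import Data.Nat using (ℕ)
open import Data.Fin using (Fin; _≟_)
open import Data.Fin.Subset using (Subset; _⊆_; _∈_; _∉_; inside; outside)
open import Data.Fin.Subset.Properties using (_∈?_)
open import Data.Vec using (Vec; _[_]=_; _[_]≔_)
open import Data.Vec.Properties
  using ([]=⇒lookup; lookup⇒[]=; lookup∘update′; []=-injective; []≔-updates; []≔-minimal)
open import Data.List using (List; []; _∷_; allFin)
open import Data.List.Relation.Unary.Any using (here; there)
open import Data.List.Membership.Propositional using () renaming (_∈_ to _∈ˡ_)
open import Data.List.Membership.Propositional.Properties using (∈-allFin)
open import Data.Product using (Σ; _×_; _,_)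
open import Relation.Nullary using (yes; no; contradiction)
open import Relation.Binary.PropositionalEquality using (_≡_; _≢_; refl; sym; trans)

[]≔-minimal⁻ : ∀ {A : Set} {m} (xs : Vec A m) {i j : Fin m} {x y : A} →
               i ≢ j → (xs [ j ]≔ y) [ i ]= x → xs [ i ]= x
[]≔-minimal⁻ xs {i} {y = y} i≢j p =
  lookup⇒[]= i xs (trans (sym (lookup∘update′ i≢j xs y)) ([]=⇒lookup p))

module _ {n : ℕ} (G : Graph n) where

  ∈-swap⁺ : ∀ {S u v v'} → u ∈ S → u ≢ v → u ∈ swap G S v v'
  ∈-swap⁺ {S} {u} {v} {v'} u∈S u≢v with u ≟ v'
  ... | yes refl = []≔-updates (S [ v ]≔ outside) u
  ... | no u≢v' = []≔-minimal _ u v' u≢v' ([]≔-minimal S u v u≢v u∈S)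

  ∈-swap⁻ : ∀ {S u v v'} → u ∈ swap G S v v' → u ≢ v' → u ∈ S
  ∈-swap⁻ {S} {u} {v} u∈S' u≢v' with u ≟ v | []≔-minimal⁻ _ u≢v' u∈S'
  ... | yes refl | u∈removed with []=-injective u∈removed ([]≔-updates S u)
  ...   | ()
  ∈-swap⁻ _ _ | no u≢v | u∈removed = []≔-minimal⁻ _ u≢v u∈removed

  swap-enters : ∀ {S u v v'} → u ∉ S → u ∈ swap G S v v' → u ≡ v'
  swap-enters {u = u} {v' = v'} u∉S u∈S' with u ≟ v'
  ... | yes u≡v' = u≡v'
  ... | no u≢v' = contradiction (∈-swap⁻ u∈S' u≢v') u∉S

  adjacent-keeps-independent : ∀ {I S S' u v} → Independent G I → AdjacentDS G S S' →
                               v ∉ S → v ∈ S' → v ∈ I → u ∈ S → u ∈ I → u ∈ S'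
  adjacent-keeps-independent {u = u} {v} ind (_ , _ , x , y , _ , _ , x~y , refl) v∉S v∈S' v∈I u∈S u∈I
    with swap-enters v∉S v∈S' | u ≟ x
  ... | refl | yes refl = contradiction x~y (ind u v u∈I v∈I)
  ... | refl | no u≢x = ∈-swap⁺ u∈S u≢x

  module _ (𝓕 : Family G) (AD : AutonomouslyDominating G 𝓕)
           {I : Subset n} (ind : Independent G I) where
    open AutonomouslyDominating AD using (extend)

    CoversOn : List (Fin n) → Subset n → Set
    CoversOn xs S = ∀ {u} → u ∈ˡ xs → u ∈ I → u ∈ S

    cover-step : ∀ {xs S} x → 𝓕 S → CoversOn xs S →
                 Σ (Subset n) λ S' → 𝓕 S' × CoversOn (x ∷ xs) S'
    cover-step {S = S} x S∈𝓕 covers with x ∈? I | x ∈? S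
    ... | no x∉I | _ = S , S∈𝓕 , λ { (here refl) x∈I → contradiction x∈I x∉I
                                   ; (there u∈xs) → covers u∈xs }
    ... | yes _ | yes x∈S = S , S∈𝓕 , λ { (here refl) _ → x∈S
                                       ; (there u∈xs) → covers u∈xs }
    ... | yes x∈I | no x∉S with extend S S∈𝓕 x x∉S
    ...   | S' , S'∈𝓕 , S~S' , x∈S' = S' , S'∈𝓕 , λ
            { (here refl) _ → x∈S'
            ; (there u∈xs) u∈I →
                adjacent-keeps-independent ind S~S' x∉S x∈S' x∈I (covers u∈xs u∈I) u∈I }

    cover : Σ (Subset n) 𝓕 → ∀ xs → Σ (Subset n) λ S → 𝓕 S × CoversOn xs S
    cover (S , S∈𝓕) [] = S , S∈𝓕 , λ ()
    cover S₀ (x ∷ xs) with cover S₀ xs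
    ... | S , S∈𝓕 , covers = cover-step x S∈𝓕 covers

mainTheorem13 : (n : ℕ) (G : Graph n) (𝓕 : Family G) →
    AutonomouslyDominating G 𝓕 →
    Σ (Subset n) 𝓕 →
    (I : Subset n) → Independent G I →
    Σ (Subset n) (λ S → 𝓕 S × I ⊆ S)
mainTheorem13 n G 𝓕 AD S₀ I ind with cover G 𝓕 AD ind S₀ (allFin n)
... | S , S∈𝓕 , covers = S , S∈𝓕 , λ {u} → covers (∈-allFin u)
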